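{- Let $(a_n)_{n\ge 1}$ be defined by $a_1=1$, $a_2=2$ and $a_{n+1}=n\,a_n+a_{n-1}$ for $n\ge 2$. Every positive integer $x$ has a legal decomposition into terms of $(a_n)$, i.e. there exist $m\ge 1$ and integers $s_1,\dots,s_m$ with $x=\sum_{i=1}^m s_i a_i$, $s_i\in\{0,1,\dots,i\}$ for all $i$, and such that whenever $s_i=i$ (with $i\ge 2$) we have $s_{i-1}=0$.
   Context: A legal decomposition of $x$ is a representation $x=\sum_{i=1}^m s_i a_i$ with $s_i\in\{0,1,\ldots,i\}$ and such that if $s_i=i$ then $s_{i-1}=0$. -}

module Defs where

open import Data.Nat using (ℕ; zero; suc; _+_; _*_; _≤_; _<_)
open import Data.Product using (_×_)
open import Relation.Binary.PropositionalEquality using (_≡_)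

-- The sequence a_n (n ≥ 1): a 1 = 1, a 2 = 2, a (n+1) = n * a n + a (n-1) for n ≥ 2.
-- a 0 is a dummy value and is never used.
a : ℕ → ℕ
a zero = 0
a (suc zero) = 1
a (suc (suc zero)) = 2
a (suc (suc (suc k))) = (suc (suc k)) * a (suc (suc k)) + a (suc k)

weightedSum : (ℕ → ℕ) → ℕ → ℕ
weightedSum s zero = 0
weightedSum s (suc m) = weightedSum s m + s (suc m) * a (suc m)

Legal : (ℕ → ℕ) → ℕ → Set
Legal s m =
  (∀ i → 1 ≤ i → i ≤ m → s i ≤ i) ×
  (∀ i → 2 ≤ i → i ≤ m → s i ≡ i → s (Data.Nat.pred i) ≡ 0)

{-# OPTIONS --safe #-}
-- Greedy algorithm: for x < a (m+1), take s m = x / a m and decompose the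
-- remainder x % a m < a m by induction. Since a (m+1) ≤ (m+1) * a m the digit
-- s m is at most m, and if it equals m (m ≥ 2) then the remainder is below
-- a (m+1) − m * a m = a (m−1), so the greedy choice of s (m−1) is 0.
module Submission where

open import Defs
open import Data.Nat
open import Data.Nat.Properties
open import Data.Nat.DivMod
open import Data.Product using (Σ; _×_; _,_)
open import Data.Sum using (inj₁; inj₂)
open import Relation.Binary.PropositionalEquality
open import Relation.Nullary using (yes; no)
open import Data.Empty using (⊥-elim)

a-unfold : ∀ k → 1 ≤ k → a (suc (suc k)) ≡ suc k * a (suc k) + a k
a-unfold (suc k) _ = refl

1+n≤a[1+n] : ∀ n → suc n ≤ a (suc n)
1+n≤a[1+n] zero = ≤-refl
1+n≤a[1+n] (suc zero) = ≤-refl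
1+n≤a[1+n] (suc (suc n)) = begin
  3 + n                                  ≡⟨ +-comm 1 (2 + n) ⟩
  (2 + n) + 1                            ≤⟨ +-mono-≤ (≤-trans (1+n≤a[1+n] (suc n)) (m≤n*m _ (2 + n)))
                                                     (≤-trans (s≤s z≤n) (1+n≤a[1+n] n)) ⟩
  (2 + n) * a (2 + n) + a (1 + n)        ∎
  where open ≤-Reasoning

0<a[1+n] : ∀ n → 0 < a (suc n)
0<a[1+n] n = ≤-trans (s≤s z≤n) (1+n≤a[1+n] n)

a[1+n]≤a[2+n] : ∀ n → a (suc n) ≤ a (suc (suc n))
a[1+n]≤a[2+n] zero = s≤s z≤n
a[1+n]≤a[2+n] (suc n) = ≤-trans (m≤n*m (a (2 + n)) (2 + n)) (m≤m+n _ (a (1 + n)))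

a[2+n]≤[2+n]*a[1+n] : ∀ n → a (suc (suc n)) ≤ suc (suc n) * a (suc n)
a[2+n]≤[2+n]*a[1+n] zero = ≤-refl
a[2+n]≤[2+n]*a[1+n] (suc n) = begin
  (2 + n) * a (2 + n) + a (1 + n)   ≤⟨ +-monoʳ-≤ ((2 + n) * a (2 + n)) (a[1+n]≤a[2+n] n) ⟩
  (2 + n) * a (2 + n) + a (2 + n)   ≡⟨ +-comm ((2 + n) * a (2 + n)) (a (2 + n)) ⟩
  (3 + n) * a (2 + n)               ∎
  where open ≤-Reasoning

remainder-< : ∀ {x n c d} .{{_ : NonZero n}} → x < c * n + d → x / n ≡ c → x % n < d
remainder-< {x} {n} {c} {d} x< x/n≡c = +-cancelʳ-< (c * n) (x % n) d (begin-strict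
  x % n + c * n       ≡⟨ cong (λ q → x % n + q * n) x/n≡c ⟨
  x % n + x / n * n   ≡⟨ m≡m%n+[m/n]*n x n ⟨
  x                   <⟨ x< ⟩
  c * n + d           ≡⟨ +-comm (c * n) d ⟩
  d + c * n           ∎)
  where open ≤-Reasoning

weightedSum-cong : ∀ {f g} m → (∀ i → i ≤ m → f i ≡ g i) → weightedSum f m ≡ weightedSum g m
weightedSum-cong zero f≗g = refl
weightedSum-cong (suc m) f≗g =
  cong₂ _+_ (weightedSum-cong m (λ i i≤m → f≗g i (m≤n⇒m≤1+n i≤m)))
            (cong (_* a (suc m)) (f≗g (suc m) ≤-refl))

update : (ℕ → ℕ) → ℕ → ℕ → ℕ → ℕ
update s k q i with i ≟ k
... | yes _ = q
... | no _ = s i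

update-same : ∀ s k q → update s k q k ≡ q
update-same s k q with k ≟ k
... | yes _ = refl
... | no k≢k = ⊥-elim (k≢k refl)

update-below : ∀ s {k} q {i} → i ≤ k → update s (suc k) q i ≡ s i
update-below s {k} q {i} i≤k with i ≟ suc k
... | yes i≡1+k = ⊥-elim (<⇒≢ (s≤s i≤k) i≡1+k)
... | no _ = refl

weightedSum-update : ∀ s k q → weightedSum (update s (suc k) q) (suc k) ≡ weightedSum s k + q * a (suc k)
weightedSum-update s k q =
  cong₂ _+_ (weightedSum-cong k (λ i i≤k → update-below s q i≤k))
            (cong (_* a (suc k)) (update-same s (suc k) q))

Legal-update : ∀ {s k q} → Legal s k → q ≤ suc k → (1 ≤ k → q ≡ suc k → s k ≡ 0) →
               Legal (update s (suc k) q) (suc k)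
Legal-update {s} {k} {q} (bounded , chained) q≤1+k top = bounded′ , chained′
  where
  bounded′ : ∀ i → 1 ≤ i → i ≤ suc k → update s (suc k) q i ≤ i
  bounded′ i 1≤i i≤1+k with m≤n⇒m<n∨m≡n i≤1+k
  ... | inj₁ (s≤s i≤k) rewrite update-below s q i≤k = bounded i 1≤i i≤k
  ... | inj₂ refl rewrite update-same s (suc k) q = q≤1+k

  chained′ : ∀ i → 2 ≤ i → i ≤ suc k → update s (suc k) q i ≡ i → update s (suc k) q (pred i) ≡ 0
  chained′ i 2≤i i≤1+k si≡i with m≤n⇒m<n∨m≡n i≤1+k
  ... | inj₁ (s≤s i≤k) rewrite update-below s q (≤-trans pred[n]≤n i≤k) =
    chained i 2≤i i≤k (trans (sym (update-below s q i≤k)) si≡i)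
  ... | inj₂ refl rewrite update-below s q (≤-refl {k}) =
    top (s≤s⁻¹ 2≤i) (trans (sym (update-same s (suc k) q)) si≡i)

-- topVanishes is the invariant that forces digit 0 below a maximal digit.
record GreedyDecomposition (m x : ℕ) : Set where
  field
    digits      : ℕ → ℕ
    legal       : Legal digits m
    sum         : x ≡ weightedSum digits m
    topVanishes : x < a m → digits m ≡ 0

greedy : ∀ m x → x < a (suc m) → GreedyDecomposition m x
greedy zero zero _ = record
  { digits      = λ _ → 0
  ; legal       = (λ _ _ _ → z≤n) , (λ _ _ _ _ → refl)
  ; sum         = refl
  ; topVanishes = λ ()
  }
greedy zero (suc x) (s≤s ())
greedy (suc k) x x<a = record
  { digits      = update digits (suc k) q
  ; legal       = Legal-update legal q≤1+k top
  ; sum         = sum′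
  ; topVanishes = λ x<n → trans (update-same digits (suc k) q) (m<n⇒m/n≡0 x<n)
  }
  where
  n = a (suc k)
  instance
    n≢0 : NonZero n
    n≢0 = >-nonZero (0<a[1+n] k)
  q = x / n
  r = x % n
  open GreedyDecomposition (greedy k r (m%n<n x n))

  q≤1+k : q ≤ suc k
  q≤1+k = s≤s⁻¹ (m<n*o⇒m/o<n (<-≤-trans x<a (a[2+n]≤[2+n]*a[1+n] k)))

  top : 1 ≤ k → q ≡ suc k → digits k ≡ 0
  top 1≤k q≡1+k = topVanishes (remainder-< (subst (x <_) (a-unfold k 1≤k) x<a) q≡1+k)

  sum′ : x ≡ weightedSum (update digits (suc k) q) (suc k)
  sum′ = begin
    x                                              ≡⟨ m≡m%n+[m/n]*n x n ⟩
    r + q * n                                      ≡⟨ cong (_+ q * n) sum ⟩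
    weightedSum digits k + q * n                   ≡⟨ weightedSum-update digits k q ⟨
    weightedSum (update digits (suc k) q) (suc k) ∎
    where open ≡-Reasoning

theorem1p2 : (x : ℕ) → 1 ≤ x →
    Σ ℕ (λ m → Σ (ℕ → ℕ) (λ s → 1 ≤ m × Legal s m × x ≡ weightedSum s m))
theorem1p2 x 1≤x = x , digits , 1≤x , legal , sum
  where open GreedyDecomposition (greedy x x (1+n≤a[1+n] x))
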